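{- Let $\mathcal{P}=(P_z)_{z\in\mathcal{L}}$ be a tree process over a finite alphabet $\Sigma$. For every $n \geq 1$ we have $\sum_{c \in \mathcal{C}_n} \mathsf{Prob}_{\mathcal{P}}(c) \leq n+1$.
   Context: A context is a finite full binary tree (every node has $0$ or $2$ children) whose nodes are labelled from $\Sigma\cup\{x\}$, $x\notin\Sigma$, where exactly one leaf is labelled $x$ (the parameter) and all other nodes are labelled from $\Sigma$. For a context $c$, $|c|$ is its number of leaves not counting the $x$-leaf, and $\mathcal{C}_n$ is the set of contexts $c$ with $|c|=n$. Nodes are identified with bit strings (path from root, $0$=left, $1$=right); $V(c)$ is the set of nodes of $c$ excluding the $x$-node. For $v\in V(c)$, $\lambda(v)=(a,i)\in\Sigma\times\{0,2\}$ gives its label and number of children. The history of a node is $h(\varepsilon)=\varepsilon$, $h(wi)=h(w)\,a\,i$ for $i\in\{0,1\}$ where $a$ is the label of $w$; histories lie in $\mathcal{L}=(\Sigma\{0,1\})^*$. A tree process is a family $(P_z)_{z\in\mathcal{L}}$ of probability distributions on $\Sigma\times\{0,2\}$, and $\mathsf{Prob}_\mathcal{P}(c)=\prod_{v\in V(c)}P_{h(v)}(\lambda(v))$ (the parameter node does not contribute). -}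

module Defs where

open import Level using (Level; _⊔_) renaming (suc to lsuc)
open import Data.Nat using (ℕ; zero; suc) renaming (_+_ to _+ℕ_)
open import Data.Fin using (Fin; zero; suc)
open import Data.Bool using (Bool; true; false)
open import Data.Product using (_×_; _,_; ∃)
open import Data.List using (List; []; _∷_; _++_; [_])
open import Relation.Nullary using (¬_)
open import Algebra.Structures using (IsCommutativeRing)
open import Relation.Binary.Structures using (IsTotalOrder)

-- The scalars: an arbitrary ordered field (the real numbers being the
-- intended instance).  Equality is a setoid equality _≈_.

record OrderedField (c ℓ₁ ℓ₂ : Level) : Set (lsuc (c ⊔ ℓ₁ ⊔ ℓ₂)) where
  infix  4 _≈_ _≤_
  infixl 6 _+_
  infixl 7 _*_
  field
    Carrier : Set c
    _≈_     : Carrier → Carrier → Set ℓ₁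
    _≤_     : Carrier → Carrier → Set ℓ₂
    _+_     : Carrier → Carrier → Carrier
    _*_     : Carrier → Carrier → Carrier
    -_      : Carrier → Carrier
    0#      : Carrier
    1#      : Carrier
    isCommutativeRing : IsCommutativeRing _≈_ _+_ _*_ -_ 0# 1#
    isTotalOrder      : IsTotalOrder _≈_ _≤_
    +-monoˡ-≤         : ∀ {x y} z → x ≤ y → x + z ≤ y + z
    *-nonneg          : ∀ {x y} → 0# ≤ x → 0# ≤ y → 0# ≤ x * y
    0≉1               : ¬ (0# ≈ 1#)
    inverse           : ∀ x → ¬ (x ≈ 0#) → ∃ λ y → x * y ≈ 1#

  fromℕ : ℕ → Carrier
  fromℕ zero    = 0#
  fromℕ (suc n) = 1# + fromℕ n

  sumList : List Carrier → Carrier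
  sumList []       = 0#
  sumList (x ∷ xs) = x + sumList xs

-- Alphabet Σ = Fin k (a finite alphabet with k letters).
-- Number of children: {0,2}.

data Arity : Set where
  zero-ch two-ch : Arity

-- Histories: words over Σ{0,1}; a bit is a Bool (false = 0 = left,
-- true = 1 = right).
History : ℕ → Set
History k = List (Fin k × Bool)

module _ {c ℓ₁ ℓ₂} (F : OrderedField c ℓ₁ ℓ₂) where
  open OrderedField F

  sumFin : ∀ {k} → (Fin k → Carrier) → Carrier
  sumFin {zero}  f = 0#
  sumFin {suc k} f = f zero + sumFin (λ i → f (suc i))

  record TreeProcess (k : ℕ) : Set (c ⊔ ℓ₁ ⊔ ℓ₂) where
    field
      P        : History k → Fin k × Arity → Carrier
      nonneg   : ∀ z σ → 0# ≤ P z σ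
      sums-to-1 : ∀ z → sumFin (λ a → P z (a , zero-ch) + P z (a , two-ch)) ≈ 1#

-- Finite full binary trees labelled by Σ (no parameter), and contexts:
-- full binary trees with exactly one leaf labelled x (the hole).

data Tree (k : ℕ) : Set where
  leaf : Fin k → Tree k
  node : Fin k → Tree k → Tree k → Tree k

data Ctx (k : ℕ) : Set where
  hole  : Ctx k
  nodeL : Fin k → Ctx k → Tree k → Ctx k
  nodeR : Fin k → Tree k → Ctx k → Ctx k

sizeT : ∀ {k} → Tree k → ℕ
sizeT (leaf a)     = 1
sizeT (node a l r) = sizeT l +ℕ sizeT r

size : ∀ {k} → Ctx k → ℕ
size hole          = 0
size (nodeL a c t) = size c +ℕ sizeT t
size (nodeR a t c) = sizeT t +ℕ size c

module _ {c ℓ₁ ℓ₂} (F : OrderedField c ℓ₁ ℓ₂) {k : ℕ} (𝒫 : TreeProcess F k) where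
  open OrderedField F
  open TreeProcess 𝒫

  probT : History k → Tree k → Carrier
  probT z (leaf a)     = P z (a , zero-ch)
  probT z (node a l r) =
    P z (a , two-ch) * (probT (z ++ [ (a , false) ]) l * probT (z ++ [ (a , true) ]) r)

  probC : History k → Ctx k → Carrier
  probC z hole          = 1#
  probC z (nodeL a c t) =
    P z (a , two-ch) * (probC (z ++ [ (a , false) ]) c * probT (z ++ [ (a , true) ]) t)
  probC z (nodeR a t c) =
    P z (a , two-ch) * (probT (z ++ [ (a , false) ]) t * probC (z ++ [ (a , true) ]) c)

  Prob : Ctx k → Carrier
  Prob = probC []

-- Grow the random tree of 𝒫 only down to depth n + 1, cutting off every branch
-- still unfinished there.  A context of size n has depth at most n + 1, so its
-- probability is the probability that it fits onto this truncated tree, its hole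
-- covering whatever sits below it.  Summing over distinct contexts therefore gives
-- the expected number of size-n contexts fitting the truncated tree, and no
-- truncated tree admits more than n + 1 of them: by induction, the contexts with
-- the hole below one child are those of that child enlarged by the other child,
-- which must be finished.
module Submission where

open import Defs
open import Data.Nat using (ℕ; suc; _≤_)
open import Data.List using (List; map)
open import Data.List.Relation.Unary.All using (All)
open import Data.List.Relation.Unary.Unique.Propositional using (Unique)
open import Relation.Binary.PropositionalEquality using (_≡_)

open import Data.List using ([]; length; filterᵇ)
import Data.List.Relation.Unary.All as All
open import Function using (_∘_)
import Data.Nat as ℕ
import Data.Nat.Properties as ℕ

module ListCounting where

  open import Data.Nat using (z≤n; s≤s; _+_; _<_)
  open import Data.Nat.Properties
    using (_≟_; _<?_; _≤?_; ≤-trans; ≤-reflexive; m≤m+n; m≤n+m; +-comm; +-identityʳ;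
           +-mono-≤; +-monoʳ-≤; +-cancelˡ-≡; +-cancelˡ-≤; <⇒≱; ≮⇒≥; ≰⇒>; m≤n⇒∃[o]m+o≡n;
           module ≤-Reasoning)
  open import Data.Product using (_,_; ∃)
  open import Data.Sum using (_⊎_; inj₁; inj₂)
  open import Data.List using (_∷_; _++_; filter)
  open import Data.List.Properties
    using (filter-++; length-++; filter-accept; filter-reject; length-removeAt′)
  open import Data.List.Membership.Propositional using (_∈_; _─_)
  open import Data.List.Relation.Unary.Any using (here; there)
  open import Data.List.Relation.Unary.AllPairs using (_∷_)
  open import Data.List.Relation.Binary.Subset.Propositional using (_⊆_)
  open import Relation.Binary.PropositionalEquality
    using (_≢_; refl; sym; trans; cong; cong₂; module ≡-Reasoning)
  open import Relation.Nullary using (yes; no; contradiction)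
  open import Relation.Unary using (Decidable)

  module _ {a} {A : Set a} where

    ∈-─⁺ : ∀ {x y} {ys : List A} (x∈ys : x ∈ ys) → x ≢ y → y ∈ ys → y ∈ ys ─ x∈ys
    ∈-─⁺ (here refl)  x≢y (here refl)  = contradiction refl x≢y
    ∈-─⁺ (here _)     x≢y (there y∈ys) = y∈ys
    ∈-─⁺ (there _)    x≢y (here refl)  = here refl
    ∈-─⁺ (there x∈ys) x≢y (there y∈ys) = there (∈-─⁺ x∈ys x≢y y∈ys)

    Unique-⊆⇒length-≤ : ∀ {xs ys : List A} → Unique xs → xs ⊆ ys → length xs ≤ length ys
    Unique-⊆⇒length-≤ {[]}          _          _     = z≤n
    Unique-⊆⇒length-≤ {x ∷ xs} {ys} (x∉xs ∷ u) xs⊆ys = begin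
      suc (length xs)          ≤⟨ s≤s (Unique-⊆⇒length-≤ u xs⊆ys─x) ⟩
      suc (length (ys ─ x∈ys)) ≡⟨ length-removeAt′ ys _ ⟨
      length ys                ∎
      where
      open ≤-Reasoning
      x∈ys = xs⊆ys (here refl)
      xs⊆ys─x : xs ⊆ ys ─ x∈ys
      xs⊆ys─x y∈xs = ∈-─⁺ x∈ys (All.lookup x∉xs y∈xs) (xs⊆ys (there y∈xs))

  below-or-offset : ∀ n s → n < s ⊎ ∃ λ m → s + m ≡ n
  below-or-offset n s with n <? s
  ... | yes n<s = inj₁ n<s
  ... | no  n≮s = inj₂ (m≤n⇒∃[o]m+o≡n (≮⇒≥ n≮s))

  module CountBy {a} {A : Set a} (w : A → ℕ) where

    weight≟ : ∀ n → Decidable (λ x → w x ≡ n)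
    weight≟ n x = w x ≟ n

    count : ℕ → List A → ℕ
    count n xs = length (filter (weight≟ n) xs)

    count-++ : ∀ n xs ys → count n (xs ++ ys) ≡ count n xs + count n ys
    count-++ n xs ys = trans (cong length (filter-++ (weight≟ n) xs ys)) (length-++ (filter (weight≟ n) xs))

    Sparse : List A → Set
    Sparse xs = ∀ n → count n xs ≤ suc n

    EmptyFrom : ℕ → List A → Set
    EmptyFrom s xs = ∀ n → s ≤ n → count n xs ≡ 0

    Shifts : ℕ → (A → A) → Set a
    Shifts s f = ∀ x → w (f x) ≡ s + w x

    module _ {s} {f : A → A} (shifts : Shifts s f) where

      count-shift : ∀ {n} m xs → s + m ≡ n → count n (map f xs) ≡ count m xs
      count-shift m []       _ = refl
      count-shift {n} m (x ∷ xs) s+m≡n with w x ≟ m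
      ... | yes wx≡m = begin
        count n (map f (x ∷ xs)) ≡⟨ cong length (filter-accept (weight≟ n) wfx≡n) ⟩
        suc (count n (map f xs)) ≡⟨ cong suc (count-shift m xs s+m≡n) ⟩
        suc (count m xs)         ≡⟨ cong length (filter-accept (weight≟ m) wx≡m) ⟨
        count m (x ∷ xs)         ∎
        where
        open ≡-Reasoning
        wfx≡n : w (f x) ≡ n
        wfx≡n = trans (shifts x) (trans (cong (s +_) wx≡m) s+m≡n)
      ... | no wx≢m = begin
        count n (map f (x ∷ xs)) ≡⟨ cong length (filter-reject (weight≟ n) wfx≢n) ⟩
        count n (map f xs)       ≡⟨ count-shift m xs s+m≡n ⟩
        count m xs               ≡⟨ cong length (filter-reject (weight≟ m) wx≢m) ⟨
        count m (x ∷ xs)         ∎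
        where
        open ≡-Reasoning
        wfx≢n : w (f x) ≢ n
        wfx≢n wfx≡n = wx≢m (+-cancelˡ-≡ s _ _ (trans (sym (shifts x)) (trans wfx≡n (sym s+m≡n))))

      count-below : ∀ {n} xs → n < s → count n (map f xs) ≡ 0
      count-below     []       _   = refl
      count-below {n} (x ∷ xs) n<s =
        trans (cong length (filter-reject (weight≟ n) wfx≢n)) (count-below xs n<s)
        where
        wfx≢n : w (f x) ≢ n
        wfx≢n wfx≡n = <⇒≱ n<s (≤-trans (m≤m+n s (w x)) (≤-reflexive (trans (sym (shifts x)) wfx≡n)))

      sparse-map : ∀ xs → Sparse xs → Sparse (map f xs)
      sparse-map xs sparse n with below-or-offset n s
      ... | inj₁ n<s         = ≤-trans (≤-reflexive (count-below xs n<s)) z≤n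
      ... | inj₂ (m , s+m≡n) = begin
        count n (map f xs) ≡⟨ count-shift m xs s+m≡n ⟩
        count m xs         ≤⟨ sparse m ⟩
        suc m              ≤⟨ s≤s (≤-trans (m≤n+m m s) (≤-reflexive s+m≡n)) ⟩
        suc n              ∎
        where open ≤-Reasoning

      emptyFrom-map : ∀ {t} xs → EmptyFrom t xs → EmptyFrom (s + t) (map f xs)
      emptyFrom-map {t} xs empty n s+t≤n with below-or-offset n s
      ... | inj₁ n<s         = count-below xs n<s
      ... | inj₂ (m , s+m≡n) = trans (count-shift m xs s+m≡n)
        (empty m (+-cancelˡ-≤ s t m (≤-trans s+t≤n (≤-reflexive (sym s+m≡n)))))

    -- Both halves are non-empty at size n only if n - s < t and n - t < s, and
    -- then (n - s + 1) + (n - t + 1) ≤ n + 1.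
    sparse-map₂ : ∀ {s t} {f g : A → A} → Shifts s f → Shifts t g → ∀ xs ys →
                  Sparse xs → EmptyFrom t xs → Sparse ys → EmptyFrom s ys →
                  ∀ n → count n (map f xs) + count n (map g ys) ≤ suc n
    sparse-map₂ {s} {t} {f} {g} f-shifts g-shifts xs ys sparse-xs empty-xs sparse-ys empty-ys n
      with below-or-offset n s | below-or-offset n t
    ... | inj₁ n<s | _ = begin
      count n (map f xs) + count n (map g ys) ≡⟨ cong (_+ count n (map g ys)) (count-below f-shifts xs n<s) ⟩
      count n (map g ys)                      ≤⟨ sparse-map g-shifts ys sparse-ys n ⟩
      suc n                                   ∎
      where open ≤-Reasoning
    ... | _ | inj₁ n<t = begin
      count n (map f xs) + count n (map g ys) ≡⟨ cong (count n (map f xs) +_) (count-below g-shifts ys n<t) ⟩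
      count n (map f xs) + 0                  ≡⟨ +-identityʳ _ ⟩
      count n (map f xs)                      ≤⟨ sparse-map f-shifts xs sparse-xs n ⟩
      suc n                                   ∎
      where open ≤-Reasoning
    ... | inj₂ (m , s+m≡n) | inj₂ (m′ , t+m′≡n) = begin
      count n (map f xs) + count n (map g ys) ≡⟨ cong₂ _+_ (count-shift f-shifts m xs s+m≡n)
                                                           (count-shift g-shifts m′ ys t+m′≡n) ⟩
      count m xs + count m′ ys                ≤⟨ bound ⟩
      suc n                                   ∎
      where
      open ≤-Reasoning
      m≤n : m ≤ n
      m≤n = ≤-trans (m≤n+m m s) (≤-reflexive s+m≡n)
      m′≤n : m′ ≤ n
      m′≤n = ≤-trans (m≤n+m m′ t) (≤-reflexive t+m′≡n)
      bound : count m xs + count m′ ys ≤ suc n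
      bound with t ≤? m | s ≤? m′
      ... | yes t≤m | _ rewrite empty-xs m t≤m = ≤-trans (sparse-ys m′) (s≤s m′≤n)
      ... | _ | yes s≤m′ rewrite empty-ys m′ s≤m′ | +-identityʳ (count m xs) =
        ≤-trans (sparse-xs m) (s≤s m≤n)
      ... | no _ | no s≰m′ = begin
        count m xs + count m′ ys ≤⟨ +-mono-≤ (sparse-xs m) (sparse-ys m′) ⟩
        suc m + suc m′           ≤⟨ s≤s (+-monoʳ-≤ m (≰⇒> s≰m′)) ⟩
        suc (m + s)              ≡⟨ cong suc (trans (+-comm m s) s+m≡n) ⟩
        suc n                    ∎

module Fitting where

  open import Data.Nat using (zero; z≤n; s≤s; _+_; _<_)
  open import Data.Nat.Properties using (≤-trans; ≤-reflexive; ≤⇒≯; m≤m+n; +-comm; +-identityʳ)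
  open import Data.Fin using (Fin)
  import Data.Fin.Properties as Fin
  open import Data.Bool using (Bool; true; false; _∧_; T)
  open import Data.Bool.Properties using (T-∧)
  open import Data.Maybe as Maybe using (Maybe; just; nothing)
  open import Data.Product using (_,_)
  open import Data.List using (_∷_; _++_; filter)
  open import Data.List.Membership.Propositional using (_∈_)
  open import Data.List.Membership.Propositional.Properties
    using (∈-map⁺; ∈-++⁺ˡ; ∈-++⁺ʳ; ∈-filter⁺; ∈-filter⁻)
  open import Data.List.Relation.Unary.Any using (here; there)
  import Data.List.Relation.Unary.Unique.Propositional.Properties as Unique
  open import Data.List.Relation.Binary.Subset.Propositional using (_⊆_)
  open import Function using (Equivalence)
  open import Relation.Binary.PropositionalEquality using (refl; trans; cong₂)
  open import Relation.Nullary using (does; yes; contradiction)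
  open import Relation.Nullary.Decidable using (T?)
  open ListCounting

  data Truncated (k : ℕ) : Set where
    cut  : Truncated k
    leaf : Fin k → Truncated k
    node : Fin k → Truncated k → Truncated k → Truncated k

  module _ {k : ℕ} where

    open CountBy (size {k})

    complete : Truncated k → Maybe (Tree k)
    complete cut          = nothing
    complete (leaf a)     = just (leaf a)
    complete (node a l r) = Maybe.zipWith (node a) (complete l) (complete r)

    fitsTree : Tree k → Truncated k → Bool
    fitsTree (leaf a)     (leaf b)     = does (a Fin.≟ b)
    fitsTree (node a l r) (node b u v) = does (a Fin.≟ b) ∧ (fitsTree l u ∧ fitsTree r v)
    fitsTree _            _            = false

    fitsCtx : Ctx k → Truncated k → Bool
    fitsCtx hole          _            = true
    fitsCtx (nodeL a c t) (node b u v) = does (a Fin.≟ b) ∧ (fitsCtx c u ∧ fitsTree t v)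
    fitsCtx (nodeR a t c) (node b u v) = does (a Fin.≟ b) ∧ (fitsTree t u ∧ fitsCtx c v)
    fitsCtx _             _            = false

    graft : Maybe (Tree k) → (Tree k → Ctx k → Ctx k) → List (Ctx k) → List (Ctx k)
    graft nothing  f cs = []
    graft (just t) f cs = map (f t) cs

    contextsIn : Truncated k → List (Ctx k)
    contextsIn (node a l r) = hole ∷ graft (complete r) (λ t c → nodeL a c t) (contextsIn l)
                                   ++ graft (complete l) (nodeR a) (contextsIn r)
    contextsIn _            = hole ∷ []

    fitsTree⇒complete : ∀ t u → T (fitsTree t u) → complete u ≡ just t
    fitsTree⇒complete (leaf a) (leaf b) fits with a Fin.≟ b
    ... | yes refl = refl
    fitsTree⇒complete (node a l r) (node b u v) fits with a Fin.≟ b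
    ... | yes refl
      with fits-l , fits-r ← Equivalence.to T-∧ fits
      rewrite fitsTree⇒complete l u fits-l | fitsTree⇒complete r v fits-r = refl

    fitsCtx⇒∈contextsIn : ∀ c u → T (fitsCtx c u) → c ∈ contextsIn u
    fitsCtx⇒∈contextsIn hole cut          _ = here refl
    fitsCtx⇒∈contextsIn hole (leaf _)     _ = here refl
    fitsCtx⇒∈contextsIn hole (node _ _ _) _ = here refl
    fitsCtx⇒∈contextsIn (nodeL a c t) (node b u v) fits with a Fin.≟ b
    ... | yes refl
      with fits-c , fits-t ← Equivalence.to T-∧ fits
      rewrite fitsTree⇒complete t v fits-t
      = there (∈-++⁺ˡ (∈-map⁺ (λ c → nodeL a c t) (fitsCtx⇒∈contextsIn c u fits-c)))
    fitsCtx⇒∈contextsIn (nodeR a t c) (node b u v) fits with a Fin.≟ b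
    ... | yes refl
      with fits-t , fits-c ← Equivalence.to T-∧ fits
      rewrite fitsTree⇒complete t u fits-t
      = there (∈-++⁺ʳ (graft (complete v) (λ t c → nodeL a c t) (contextsIn u))
                      (∈-map⁺ (nodeR a t) (fitsCtx⇒∈contextsIn c v fits-c)))

    sizeT-positive : (t : Tree k) → 0 < sizeT t
    sizeT-positive (leaf _)     = s≤s z≤n
    sizeT-positive (node _ l _) = ≤-trans (sizeT-positive l) (m≤m+n _ _)

    nodeL-shifts : ∀ a t → Shifts (sizeT t) (λ c → nodeL a c t)
    nodeL-shifts a t c = +-comm (size c) (sizeT t)

    nodeR-shifts : ∀ a t → Shifts (sizeT t) (nodeR a t)
    nodeR-shifts a t c = refl

    module _ (f : Tree k → Ctx k → Ctx k) (shifts : ∀ t → Shifts (sizeT t) (f t)) where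

      sparse-graft : ∀ mt cs → Sparse cs → Sparse (graft mt f cs)
      sparse-graft nothing  _  _      n = z≤n
      sparse-graft (just t) cs sparse n = sparse-map (shifts t) cs sparse n

      graft-holeless : ∀ mt cs → count 0 (graft mt f cs) ≡ 0
      graft-holeless nothing  cs = refl
      graft-holeless (just t) cs = count-below (shifts t) cs (sizeT-positive t)

    record Profile (u : Truncated k) : Set where
      field
        sparse    : Sparse (contextsIn u)
        emptyFrom : ∀ {t} → complete u ≡ just t → EmptyFrom (sizeT t) (contextsIn u)

    profile : ∀ u → Profile u
    profile cut          = record { sparse = λ { zero → s≤s z≤n ; (suc n) → z≤n } ; emptyFrom = λ () }
    profile (leaf a)     = record { sparse    = λ { zero → s≤s z≤n ; (suc n) → z≤n }
                                  ; emptyFrom = λ { refl (suc n) _ → refl } }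
    profile (node a l r) = record { sparse = sparse ; emptyFrom = emptyFrom }
      where
      module L = Profile (profile l)
      module R = Profile (profile r)
      left  = graft (complete r) (λ t c → nodeL a c t) (contextsIn l)
      right = graft (complete l) (nodeR a) (contextsIn r)

      sparse : Sparse (contextsIn (node a l r))
      sparse zero = s≤s (≤-reflexive (trans (count-++ 0 left right) (cong₂ _+_
        (graft-holeless (λ t c → nodeL a c t) (nodeL-shifts a) (complete r) (contextsIn l))
        (graft-holeless (nodeR a) (nodeR-shifts a) (complete l) (contextsIn r)))))
      sparse (suc n) rewrite count-++ (suc n) left right with complete l in el | complete r in er
      ... | just tl | just tr = sparse-map₂ {f = λ c → nodeL a c tr} {g = nodeR a tl}
        (nodeL-shifts a tr) (nodeR-shifts a tl) (contextsIn l) (contextsIn r)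
        L.sparse (L.emptyFrom el) R.sparse (R.emptyFrom er) (suc n)
      ... | ml | nothing = sparse-graft (nodeR a) (nodeR-shifts a) ml (contextsIn r) R.sparse (suc n)
      ... | nothing | just tr = ≤-trans (≤-reflexive (+-identityʳ _))
        (sparse-graft (λ t c → nodeL a c t) (nodeL-shifts a) (just tr) (contextsIn l) L.sparse (suc n))

      emptyFrom : ∀ {t} → complete (node a l r) ≡ just t → EmptyFrom (sizeT t) (contextsIn (node a l r))
      emptyFrom {t} _ zero t≤0 = contradiction (sizeT-positive t) (≤⇒≯ t≤0)
      emptyFrom _ (suc n) _ rewrite count-++ (suc n) left right with complete l in el | complete r in er
      emptyFrom refl (suc n) tl+tr≤n | just tl | just tr = cong₂ _+_
        (emptyFrom-map (nodeL-shifts a tr) (contextsIn l) (L.emptyFrom el) (suc n)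
          (≤-trans (≤-reflexive (+-comm (sizeT tr) (sizeT tl))) tl+tr≤n))
        (emptyFrom-map (nodeR-shifts a tl) (contextsIn r) (R.emptyFrom er) (suc n) tl+tr≤n)

    fitting-≤ : ∀ {n} {cs : List (Ctx k)} → Unique cs → All (λ c → size c ≡ n) cs →
                ∀ u → length (filterᵇ (λ c → fitsCtx c u) cs) ≤ suc n
    fitting-≤ {n} {cs} unique sizes u = ≤-trans
      (Unique-⊆⇒length-≤ (Unique.filter⁺ (T? ∘ fits) unique) fitting⊆sized)
      (Profile.sparse (profile u) n)
      where
      fits : Ctx k → Bool
      fits c = fitsCtx c u
      fitting⊆sized : filterᵇ fits cs ⊆ filter (weight≟ n) (contextsIn u)
      fitting⊆sized c∈ with c∈cs , c-fits ← ∈-filter⁻ (T? ∘ fits) c∈ =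
        ∈-filter⁺ (weight≟ n) (fitsCtx⇒∈contextsIn _ u c-fits) (All.lookup sizes c∈cs)

module OrderedFieldProperties {c ℓ₁ ℓ₂} (F : OrderedField c ℓ₁ ℓ₂) where

  open import Data.Nat using (zero; z≤n; s≤s)
  open import Data.Fin using (Fin; zero; suc)
  open import Data.Fin.Properties using (_≟_)
  open import Data.Bool using (Bool; true; false; _∧_)
  open import Data.Sum using (inj₁; inj₂)
  open import Data.List using (_∷_)
  open import Relation.Binary.PropositionalEquality as ≡ using ()
  open import Relation.Nullary using (does)
  open import Algebra.Bundles using (CommutativeRing)
  open import Algebra.Structures using (IsCommutativeRing)
  open import Relation.Binary.Bundles using (Poset)
  open import Relation.Binary.Structures using (IsTotalOrder)
  import Algebra.Properties.Ring as RingProperties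
  import Algebra.Properties.Semiring.Sum as SemiringSum
  import Algebra.Properties.CommutativeSemigroup as CommutativeSemigroupProperties
  import Relation.Binary.Reasoning.PartialOrder as PartialOrderReasoning

  open OrderedField F public renaming (_≤_ to _≤ᶠ_)
  open IsCommutativeRing isCommutativeRing public hiding (zero)
  open IsTotalOrder isTotalOrder using (total; isPartialOrder)
    renaming (refl to ≤-refl; trans to ≤-trans)

  commutativeRing : CommutativeRing c ℓ₁
  commutativeRing = record { isCommutativeRing = isCommutativeRing }

  poset : Poset c ℓ₁ ℓ₂
  poset = record { isPartialOrder = isPartialOrder }

  open RingProperties (CommutativeRing.ring commutativeRing) using (-1*x≈-x; -‿involutive)
  open SemiringSum (CommutativeRing.semiring commutativeRing) public
    using (sum; sum-cong-≋; sum-replicate-zero; ∑-distrib-+; *-distribˡ-sum; *-distribʳ-sum)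
  open CommutativeSemigroupProperties (CommutativeRing.+-commutativeSemigroup commutativeRing)
    public using (interchange)
  open CommutativeSemigroupProperties (CommutativeRing.*-commutativeSemigroup commutativeRing)
    public using (x∙yz≈y∙xz)
  open PartialOrderReasoning poset public

  +-monoʳ-≤ : ∀ {x y} z → x ≤ᶠ y → z + x ≤ᶠ z + y
  +-monoʳ-≤ {x} {y} z x≤y = begin
    z + x ≈⟨ +-comm z x ⟩
    x + z ≤⟨ +-monoˡ-≤ z x≤y ⟩
    y + z ≈⟨ +-comm y z ⟩
    z + y ∎

  +-mono-≤ : ∀ {x y u v} → x ≤ᶠ y → u ≤ᶠ v → x + u ≤ᶠ y + v
  +-mono-≤ {y = y} {u} x≤y u≤v = ≤-trans (+-monoˡ-≤ u x≤y) (+-monoʳ-≤ y u≤v)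

  x≤y⇒0≤y-x : ∀ {x y} → x ≤ᶠ y → 0# ≤ᶠ y + - x
  x≤y⇒0≤y-x {x} {y} x≤y = begin
    0#      ≈⟨ -‿inverseʳ x ⟨
    x + - x ≤⟨ +-monoˡ-≤ (- x) x≤y ⟩
    y + - x ∎

  *-monoˡ-≤ : ∀ {a x y} → 0# ≤ᶠ a → x ≤ᶠ y → a * x ≤ᶠ a * y
  *-monoˡ-≤ {a} {x} {y} 0≤a x≤y = begin
    a * x                 ≈⟨ +-identityˡ (a * x) ⟨
    0# + a * x            ≤⟨ +-monoˡ-≤ (a * x) (*-nonneg 0≤a (x≤y⇒0≤y-x x≤y)) ⟩
    a * (y + - x) + a * x ≈⟨ distribˡ a (y + - x) x ⟨
    a * ((y + - x) + x)   ≈⟨ *-congˡ (+-assoc y (- x) x) ⟩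
    a * (y + (- x + x))   ≈⟨ *-congˡ (+-congˡ (-‿inverseˡ x)) ⟩
    a * (y + 0#)          ≈⟨ *-congˡ (+-identityʳ y) ⟩
    a * y                 ∎

  0≤1 : 0# ≤ᶠ 1#
  0≤1 with total 0# 1#
  ... | inj₁ 0≤1 = 0≤1
  ... | inj₂ 1≤0 = begin
    0#          ≤⟨ *-nonneg 0≤-1 0≤-1 ⟩
    - 1# * - 1# ≈⟨ -1*x≈-x (- 1#) ⟩
    - - 1#      ≈⟨ -‿involutive 1# ⟩
    1#          ∎
    where
    0≤-1 : 0# ≤ᶠ - 1#
    0≤-1 = begin
      0#        ≈⟨ -‿inverseʳ 1# ⟨
      1# + - 1# ≤⟨ +-monoˡ-≤ (- 1#) 1≤0 ⟩
      0# + - 1# ≈⟨ +-identityˡ (- 1#) ⟩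
      - 1#      ∎

  0≤fromℕ : ∀ n → 0# ≤ᶠ fromℕ n
  0≤fromℕ zero    = ≤-refl
  0≤fromℕ (suc n) = begin
    0#           ≈⟨ +-identityˡ 0# ⟨
    0# + 0#      ≤⟨ +-mono-≤ 0≤1 (0≤fromℕ n) ⟩
    1# + fromℕ n ∎

  fromℕ-mono-≤ : ∀ {m n} → m ≤ n → fromℕ m ≤ᶠ fromℕ n
  fromℕ-mono-≤ {n = n} z≤n = 0≤fromℕ n
  fromℕ-mono-≤ (s≤s m≤n)   = +-monoʳ-≤ 1# (fromℕ-mono-≤ m≤n)

  sum-mono-≤ : ∀ {k} {f g : Fin k → Carrier} → (∀ i → f i ≤ᶠ g i) → sum f ≤ᶠ sum g
  sum-mono-≤ {zero}  f≤g = ≤-refl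
  sum-mono-≤ {suc k} f≤g = +-mono-≤ (f≤g zero) (sum-mono-≤ (λ i → f≤g (suc i)))

  sumFin≡sum : ∀ {k} (f : Fin k → Carrier) → sumFin F f ≡ sum f
  sumFin≡sum {zero}  f = ≡.refl
  sumFin≡sum {suc k} f = ≡.cong (f zero +_) (sumFin≡sum (f ∘ suc))

  sumList-cong : ∀ {a} {A : Set a} {f g : A → Carrier} {xs} → All (λ x → f x ≈ g x) xs →
                 sumList (map f xs) ≈ sumList (map g xs)
  sumList-cong All.[]          = refl
  sumList-cong (fx≈gx All.∷ e) = +-cong fx≈gx (sumList-cong e)

  𝟙 : Bool → Carrier
  𝟙 true  = 1#
  𝟙 false = 0#

  𝟙-∧ : ∀ x y → 𝟙 (x ∧ y) ≈ 𝟙 x * 𝟙 y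
  𝟙-∧ true  y = sym (*-identityˡ (𝟙 y))
  𝟙-∧ false y = sym (zeroˡ (𝟙 y))

  𝟙-∧-∧ : ∀ x y w → 𝟙 (x ∧ (y ∧ w)) ≈ 𝟙 x * (𝟙 y * 𝟙 w)
  𝟙-∧-∧ x y w = trans (𝟙-∧ x (y ∧ w)) (*-congˡ (𝟙-∧ y w))

  sumList-𝟙 : ∀ {a} {A : Set a} (p : A → Bool) xs →
              sumList (map (𝟙 ∘ p) xs) ≈ fromℕ (length (filterᵇ p xs))
  sumList-𝟙 p []       = refl
  sumList-𝟙 p (x ∷ xs) with p x
  ... | true  = +-congˡ (sumList-𝟙 p xs)
  ... | false = trans (+-identityˡ _) (sumList-𝟙 p xs)

  ∑-δ : ∀ {k} (a : Fin k) (f : Fin k → Carrier) → sum (λ b → 𝟙 (does (a ≟ b)) * f b) ≈ f a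
  ∑-δ {suc k} zero f = begin-equality
    1# * f zero + sum {k} (λ b → 0# * f (suc b)) ≈⟨ +-cong (*-identityˡ (f zero))
                                                           (sum-cong-≋ {k} (λ b → zeroˡ (f (suc b)))) ⟩
    f zero + sum {k} (λ _ → 0#)                  ≈⟨ +-congˡ (sum-replicate-zero k) ⟩
    f zero + 0#                                  ≈⟨ +-identityʳ (f zero) ⟩
    f zero                                       ∎
  ∑-δ (suc a) f = begin-equality
    0# * f zero + sum (λ b → 𝟙 (does (a ≟ b)) * f (suc b)) ≈⟨ +-cong (zeroˡ (f zero)) (∑-δ a (f ∘ suc)) ⟩
    0# + f (suc a)                                         ≈⟨ +-identityˡ (f (suc a)) ⟩
    f (suc a)                                              ∎

module Expectation {c ℓ₁ ℓ₂} (F : OrderedField c ℓ₁ ℓ₂) {k : ℕ} (𝒫 : TreeProcess F k) where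

  open import Data.Nat using (zero)
  open import Data.Nat.Properties using (≤-pred; ≤⇒≯; <-≤-trans; m<m+n; m<n+m; m+n≤o⇒m≤o; m+n≤o⇒n≤o)
  open import Data.Fin using (Fin)
  open import Data.Fin.Properties using (_≟_)
  open import Data.Bool using (true; false)
  open import Data.Product using (_,_)
  open import Data.List using (_∷_; _∷ʳ_)
  import Relation.Binary.PropositionalEquality as ≡
  open import Relation.Nullary using (does; contradiction)
  open OrderedFieldProperties F
  open Fitting using (Truncated; cut; leaf; node; fitsTree; fitsCtx; sizeT-positive)
  open TreeProcess 𝒫

  -- 𝔼 D z g is the expected value of g on the tree grown by 𝒫 from history z,
  -- with every branch still unfinished at depth D replaced by cut.
  𝔼 : ℕ → History k → (Truncated k → Carrier) → Carrier
  branch : ℕ → History k → (Truncated k → Carrier) → Fin k → Carrier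
  𝔼 zero    z g = g cut
  𝔼 (suc D) z g = sum (branch D z g)
  branch D z g a = P z (a , zero-ch) * g (leaf a)
                 + P z (a , two-ch) * 𝔼 D (z ∷ʳ (a , false)) λ l → 𝔼 D (z ∷ʳ (a , true)) λ r → g (node a l r)

  𝔼-cong : ∀ D z {g h} → (∀ u → g u ≈ h u) → 𝔼 D z g ≈ 𝔼 D z h
  𝔼-cong zero    z g≈h = g≈h cut
  𝔼-cong (suc D) z g≈h = sum-cong-≋ λ a → +-cong (*-congˡ (g≈h (leaf a)))
    (*-congˡ (𝔼-cong D _ λ l → 𝔼-cong D _ λ r → g≈h (node a l r)))

  𝔼-mono : ∀ D z {g h} → (∀ u → g u ≤ᶠ h u) → 𝔼 D z g ≤ᶠ 𝔼 D z h
  𝔼-mono zero    z g≤h = g≤h cut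
  𝔼-mono (suc D) z g≤h = sum-mono-≤ λ a → +-mono-≤ (*-monoˡ-≤ (nonneg _ _) (g≤h (leaf a)))
    (*-monoˡ-≤ (nonneg _ _) (𝔼-mono D _ λ l → 𝔼-mono D _ λ r → g≤h (node a l r)))

  𝔼-+ : ∀ D z g h → 𝔼 D z (λ u → g u + h u) ≈ 𝔼 D z g + 𝔼 D z h
  𝔼-+ zero    z g h = refl
  𝔼-+ (suc D) z g h = begin-equality
    sum (branch D z (λ u → g u + h u))         ≈⟨ sum-cong-≋ branch-+ ⟩
    sum (λ a → branch D z g a + branch D z h a) ≈⟨ ∑-distrib-+ (branch D z g) (branch D z h) ⟩
    sum (branch D z g) + sum (branch D z h)     ∎
    where
    branch-+ : ∀ a → branch D z (λ u → g u + h u) a ≈ branch D z g a + branch D z h a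
    branch-+ a = begin-equality
      p₀ * (g (leaf a) + h (leaf a)) + p₂ * 𝔼 D z₀ (λ l → 𝔼 D z₁ λ r → gₐ l r + hₐ l r)
        ≈⟨ +-cong (distribˡ p₀ _ _)
                  (*-congˡ (trans (𝔼-cong D z₀ λ l → 𝔼-+ D z₁ (gₐ l) (hₐ l)) (𝔼-+ D z₀ _ _))) ⟩
      (p₀ * g (leaf a) + p₀ * h (leaf a)) + p₂ * (𝔼₂ gₐ + 𝔼₂ hₐ)
        ≈⟨ +-congˡ (distribˡ p₂ _ _) ⟩
      (p₀ * g (leaf a) + p₀ * h (leaf a)) + (p₂ * 𝔼₂ gₐ + p₂ * 𝔼₂ hₐ)
        ≈⟨ interchange _ _ _ _ ⟩
      branch D z g a + branch D z h a ∎
      where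
      p₀ = P z (a , zero-ch)
      p₂ = P z (a , two-ch)
      z₀ = z ∷ʳ (a , false)
      z₁ = z ∷ʳ (a , true)
      gₐ = λ l r → g (node a l r)
      hₐ = λ l r → h (node a l r)
      𝔼₂ : (Truncated k → Truncated k → Carrier) → Carrier
      𝔼₂ q = 𝔼 D z₀ λ l → 𝔼 D z₁ (q l)

  𝔼-*ˡ : ∀ D z x g → 𝔼 D z (λ u → x * g u) ≈ x * 𝔼 D z g
  𝔼-*ˡ zero    z x g = refl
  𝔼-*ˡ (suc D) z x g = begin-equality
    sum (branch D z (λ u → x * g u))   ≈⟨ sum-cong-≋ branch-*ˡ ⟩
    sum (λ a → x * branch D z g a)     ≈⟨ *-distribˡ-sum x (branch D z g) ⟨
    x * sum (branch D z g)             ∎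
    where
    branch-*ˡ : ∀ a → branch D z (λ u → x * g u) a ≈ x * branch D z g a
    branch-*ˡ a = begin-equality
      p₀ * (x * g (leaf a)) + p₂ * 𝔼 D z₀ (λ l → 𝔼 D z₁ λ r → x * gₐ l r)
        ≈⟨ +-congˡ (*-congˡ (trans (𝔼-cong D z₀ λ l → 𝔼-*ˡ D z₁ x (gₐ l)) (𝔼-*ˡ D z₀ x _))) ⟩
      p₀ * (x * g (leaf a)) + p₂ * (x * 𝔼 D z₀ (λ l → 𝔼 D z₁ (gₐ l)))
        ≈⟨ +-cong (x∙yz≈y∙xz p₀ x _) (x∙yz≈y∙xz p₂ x _) ⟩
      x * (p₀ * g (leaf a)) + x * (p₂ * 𝔼 D z₀ (λ l → 𝔼 D z₁ (gₐ l)))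
        ≈⟨ distribˡ x _ _ ⟨
      x * branch D z g a ∎
      where
      p₀ = P z (a , zero-ch)
      p₂ = P z (a , two-ch)
      z₀ = z ∷ʳ (a , false)
      z₁ = z ∷ʳ (a , true)
      gₐ = λ l r → g (node a l r)

  𝔼-const : ∀ D z x → 𝔼 D z (λ _ → x) ≈ x
  𝔼-const zero    z x = refl
  𝔼-const (suc D) z x = begin-equality
    sum (branch D z (λ _ → x))  ≈⟨ sum-cong-≋ branch-const ⟩
    sum (λ a → pₐ a * x)        ≈⟨ *-distribʳ-sum x pₐ ⟨
    sum pₐ * x                  ≈⟨ *-congʳ (trans (reflexive (≡.sym (sumFin≡sum pₐ))) (sums-to-1 z)) ⟩
    1# * x                      ≈⟨ *-identityˡ x ⟩
    x                           ∎
    where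
    pₐ : Fin k → Carrier
    pₐ a = P z (a , zero-ch) + P z (a , two-ch)
    branch-const : ∀ a → branch D z (λ _ → x) a ≈ pₐ a * x
    branch-const a = trans
      (+-congˡ (*-congˡ (trans (𝔼-cong D _ λ _ → 𝔼-const D _ x) (𝔼-const D _ x))))
      (sym (distribʳ x _ _))

  𝔼-product : ∀ D z z′ f h → 𝔼 D z (λ l → 𝔼 D z′ λ r → f l * h r) ≈ 𝔼 D z f * 𝔼 D z′ h
  𝔼-product D z z′ f h = begin-equality
    𝔼 D z (λ l → 𝔼 D z′ λ r → f l * h r) ≈⟨ 𝔼-cong D z (λ l → 𝔼-*ˡ D z′ (f l) h) ⟩
    𝔼 D z (λ l → f l * 𝔼 D z′ h)         ≈⟨ 𝔼-cong D z (λ l → *-comm (f l) _) ⟩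
    𝔼 D z (λ l → 𝔼 D z′ h * f l)         ≈⟨ 𝔼-*ˡ D z (𝔼 D z′ h) f ⟩
    𝔼 D z′ h * 𝔼 D z f                   ≈⟨ *-comm _ _ ⟩
    𝔼 D z f * 𝔼 D z′ h                   ∎

  𝔼-sumList : ∀ {a} {A : Set a} D z (g : A → Truncated k → Carrier) xs →
              sumList (map (λ x → 𝔼 D z (g x)) xs) ≈ 𝔼 D z (λ u → sumList (map (λ x → g x u) xs))
  𝔼-sumList D z g []       = sym (𝔼-const D z 0#)
  𝔼-sumList D z g (x ∷ xs) = trans (+-congˡ (𝔼-sumList D z g xs)) (sym (𝔼-+ D z (g x) _))

  𝔼-zero : ∀ D z {g} → (∀ u → g u ≈ 0#) → 𝔼 D z g ≈ 0#
  𝔼-zero D z g≈0 = trans (𝔼-cong D z g≈0) (𝔼-const D z 0#)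

  𝔼-leaf : ∀ D z a g → (∀ b → g (leaf b) ≈ 𝟙 (does (a ≟ b))) → (∀ b l r → g (node b l r) ≈ 0#) →
           𝔼 (suc D) z g ≈ P z (a , zero-ch)
  𝔼-leaf D z a g at-leaf at-node = trans (sum-cong-≋ branch-δ) (∑-δ a λ b → P z (b , zero-ch))
    where
    branch-δ : ∀ b → branch D z g b ≈ 𝟙 (does (a ≟ b)) * P z (b , zero-ch)
    branch-δ b = begin-equality
      P z (b , zero-ch) * g (leaf b) + P z (b , two-ch) * 𝔼 D _ (λ l → 𝔼 D _ λ r → g (node b l r))
        ≈⟨ +-cong (*-congˡ (at-leaf b)) (*-congˡ (𝔼-zero D _ λ l → 𝔼-zero D _ (at-node b l))) ⟩
      P z (b , zero-ch) * 𝟙 (does (a ≟ b)) + P z (b , two-ch) * 0#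
        ≈⟨ trans (+-congˡ (zeroʳ _)) (+-identityʳ _) ⟩
      P z (b , zero-ch) * 𝟙 (does (a ≟ b))
        ≈⟨ *-comm _ _ ⟩
      𝟙 (does (a ≟ b)) * P z (b , zero-ch) ∎

  𝔼-node : ∀ D z a g f h → (∀ b → g (leaf b) ≈ 0#) →
           (∀ b l r → g (node b l r) ≈ 𝟙 (does (a ≟ b)) * (f l * h r)) →
           𝔼 (suc D) z g ≈ P z (a , two-ch) * (𝔼 D (z ∷ʳ (a , false)) f * 𝔼 D (z ∷ʳ (a , true)) h)
  𝔼-node D z a g f h at-leaf at-node = trans (sum-cong-≋ branch-δ) (∑-δ a children)
    where
    children : Fin k → Carrier
    children b = P z (b , two-ch) * (𝔼 D (z ∷ʳ (b , false)) f * 𝔼 D (z ∷ʳ (b , true)) h)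
    branch-δ : ∀ b → branch D z g b ≈ 𝟙 (does (a ≟ b)) * children b
    branch-δ b = begin-equality
      p₀ * g (leaf b) + p₂ * 𝔼 D z₀ (λ l → 𝔼 D z₁ λ r → g (node b l r))
        ≈⟨ +-cong (*-congˡ (at-leaf b)) (*-congˡ (𝔼-cong D z₀ λ l → 𝔼-cong D z₁ (at-node b l))) ⟩
      p₀ * 0# + p₂ * 𝔼 D z₀ (λ l → 𝔼 D z₁ λ r → δ * (f l * h r))
        ≈⟨ +-cong (zeroʳ p₀)
                  (*-congˡ (trans (𝔼-cong D z₀ λ l → 𝔼-*ˡ D z₁ δ λ r → f l * h r) (𝔼-*ˡ D z₀ δ _))) ⟩
      0# + p₂ * (δ * 𝔼 D z₀ (λ l → 𝔼 D z₁ λ r → f l * h r))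
        ≈⟨ trans (+-identityˡ _) (*-congˡ (*-congˡ (𝔼-product D z₀ z₁ f h))) ⟩
      p₂ * (δ * (𝔼 D z₀ f * 𝔼 D z₁ h))
        ≈⟨ x∙yz≈y∙xz p₂ δ _ ⟩
      δ * children b ∎
      where
      p₀ = P z (b , zero-ch)
      p₂ = P z (b , two-ch)
      z₀ = z ∷ʳ (b , false)
      z₁ = z ∷ʳ (b , true)
      δ  = 𝟙 (does (a ≟ b))

  𝔼-fitsTree : ∀ D z t → sizeT t ≤ D → 𝔼 D z (𝟙 ∘ fitsTree t) ≈ probT F 𝒫 z t
  𝔼-fitsTree zero    z t            t≤0 = contradiction (sizeT-positive t) (≤⇒≯ t≤0)
  𝔼-fitsTree (suc D) z (leaf a)     _   =
    𝔼-leaf D z a (𝟙 ∘ fitsTree (leaf a)) (λ _ → refl) (λ _ _ _ → refl)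
  𝔼-fitsTree (suc D) z (node a l r) l+r≤1+D = begin-equality
    𝔼 (suc D) z (𝟙 ∘ fitsTree (node a l r))
      ≈⟨ 𝔼-node D z a (𝟙 ∘ fitsTree (node a l r)) (𝟙 ∘ fitsTree l) (𝟙 ∘ fitsTree r) (λ _ → refl)
                (λ b u v → 𝟙-∧-∧ (does (a ≟ b)) (fitsTree l u) (fitsTree r v)) ⟩
    P z (a , two-ch) * (𝔼 D _ (𝟙 ∘ fitsTree l) * 𝔼 D _ (𝟙 ∘ fitsTree r))
      ≈⟨ *-congˡ (*-cong (𝔼-fitsTree D _ l l≤D) (𝔼-fitsTree D _ r r≤D)) ⟩
    probT F 𝒫 z (node a l r) ∎
    where
    l≤D = ≤-pred (<-≤-trans (m<m+n (sizeT l) (sizeT-positive r)) l+r≤1+D)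
    r≤D = ≤-pred (<-≤-trans (m<n+m (sizeT r) (sizeT-positive l)) l+r≤1+D)

  𝔼-fitsCtx : ∀ D z c → size c ℕ.< D → 𝔼 D z (𝟙 ∘ fitsCtx c) ≈ probC F 𝒫 z c
  𝔼-fitsCtx D       z hole          _ = 𝔼-const D z 1#
  𝔼-fitsCtx (suc D) z (nodeL a c t) (ℕ.s≤s c+t≤D) = begin-equality
    𝔼 (suc D) z (𝟙 ∘ fitsCtx (nodeL a c t))
      ≈⟨ 𝔼-node D z a (𝟙 ∘ fitsCtx (nodeL a c t)) (𝟙 ∘ fitsCtx c) (𝟙 ∘ fitsTree t) (λ _ → refl)
                (λ b u v → 𝟙-∧-∧ (does (a ≟ b)) (fitsCtx c u) (fitsTree t v)) ⟩
    P z (a , two-ch) * (𝔼 D _ (𝟙 ∘ fitsCtx c) * 𝔼 D _ (𝟙 ∘ fitsTree t))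
      ≈⟨ *-congˡ (*-cong (𝔼-fitsCtx D _ c c<D) (𝔼-fitsTree D _ t (m+n≤o⇒n≤o (size c) c+t≤D))) ⟩
    probC F 𝒫 z (nodeL a c t) ∎
    where
    c<D = <-≤-trans (m<m+n (size c) (sizeT-positive t)) c+t≤D
  𝔼-fitsCtx (suc D) z (nodeR a t c) (ℕ.s≤s t+c≤D) = begin-equality
    𝔼 (suc D) z (𝟙 ∘ fitsCtx (nodeR a t c))
      ≈⟨ 𝔼-node D z a (𝟙 ∘ fitsCtx (nodeR a t c)) (𝟙 ∘ fitsTree t) (𝟙 ∘ fitsCtx c) (λ _ → refl)
                (λ b u v → 𝟙-∧-∧ (does (a ≟ b)) (fitsTree t u) (fitsCtx c v)) ⟩
    P z (a , two-ch) * (𝔼 D _ (𝟙 ∘ fitsTree t) * 𝔼 D _ (𝟙 ∘ fitsCtx c))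
      ≈⟨ *-congˡ (*-cong (𝔼-fitsTree D _ t (m+n≤o⇒m≤o (sizeT t) t+c≤D)) (𝔼-fitsCtx D _ c c<D)) ⟩
    probC F 𝒫 z (nodeR a t c) ∎
    where
    c<D = <-≤-trans (m<n+m (size c) (sizeT-positive t)) t+c≤D

mainTheorem3 : ∀ {c ℓ₁ ℓ₂} (F : OrderedField c ℓ₁ ℓ₂) (k : ℕ) (𝒫 : TreeProcess F k)
                 (n : ℕ) → 1 ≤ n →
                 (cs : List (Ctx k)) → Unique cs → All (λ t → size t ≡ n) cs →
                 OrderedField._≤_ F (OrderedField.sumList F (map (Prob F 𝒫) cs))
                                    (OrderedField.fromℕ F (suc n))
mainTheorem3 F k 𝒫 n _ cs unique sizes = begin
  sumList (map (Prob F 𝒫) cs)                                   ≈⟨ sumList-cong Prob≈𝔼 ⟩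
  sumList (map (λ c → 𝔼 (suc n) [] (𝟙 ∘ fitsCtx c)) cs)         ≈⟨ 𝔼-sumList (suc n) [] (λ c → 𝟙 ∘ fitsCtx c) cs ⟩
  𝔼 (suc n) [] (λ u → sumList (map (λ c → 𝟙 (fitsCtx c u)) cs)) ≤⟨ 𝔼-mono (suc n) [] fitting≤n+1 ⟩
  𝔼 (suc n) [] (λ _ → fromℕ (suc n))                            ≈⟨ 𝔼-const (suc n) [] (fromℕ (suc n)) ⟩
  fromℕ (suc n)                                                 ∎
  where
  open OrderedFieldProperties F
  open Expectation F 𝒫
  open Fitting using (fitsCtx; fitting-≤)
  Prob≈𝔼 : All (λ c → Prob F 𝒫 c ≈ 𝔼 (suc n) [] (𝟙 ∘ fitsCtx c)) cs
  Prob≈𝔼 = All.map (λ {c} size≡n → sym (𝔼-fitsCtx (suc n) [] c (ℕ.s≤s (ℕ.≤-reflexive size≡n)))) sizes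
  fitting≤n+1 : ∀ u → sumList (map (λ c → 𝟙 (fitsCtx c u)) cs) ≤ᶠ fromℕ (suc n)
  fitting≤n+1 u = begin
    sumList (map (λ c → 𝟙 (fitsCtx c u)) cs)         ≈⟨ sumList-𝟙 (λ c → fitsCtx c u) cs ⟩
    fromℕ (length (filterᵇ (λ c → fitsCtx c u) cs)) ≤⟨ fromℕ-mono-≤ (fitting-≤ unique sizes u) ⟩
    fromℕ (suc n)                                   ∎
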